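{- Let $n\ge 3$ and $0\le m\le 8$ be integers. Then the cycle pendant star $C_n\star P_2\star S_m$ has a prime vertex labeling.
   Context: All graphs are simple and connected. A graph with $N$ vertices has a prime vertex labeling (is "prime") if its vertices can be labeled bijectively with the integers $1,2,\ldots,N$ so that any two adjacent vertices receive relatively prime labels. $C_n$ denotes the cycle on $n$ vertices. The cycle pendant star $C_n\star P_2\star S_m$ is the graph obtained from the cycle $C_n$ with vertices $c_1,\ldots,c_n$ as follows: for each $i$ add a new vertex $p_i$ adjacent to $c_i$ (so each cycle vertex gets one pendant edge), and then for each $i$ add $m$ further new vertices $o_{i,1},\ldots,o_{i,m}$, each adjacent only to $p_i$ (i.e., the star $S_m$ is attached at its center to each $p_i$). It has $(m+2)n$ vertices. -}

module Defs where

open import Data.Nat using (ℕ; suc; _+_; _*_)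
open import Data.Nat.Coprimality using (Coprime)
open import Data.Fin using (Fin; toℕ)
open import Data.Product using (_×_)
open import Relation.Binary.PropositionalEquality using (_≡_)
open import Function.Bundles using (_⤖_; Bijection)

-- Vertices of the cycle pendant star  C_n ⋆ P_2 ⋆ S_m  (with (m+2)n vertices).
--   cyc i     : cycle vertex c_i
--   pend i    : pendant vertex p_i, adjacent to c_i
--   leaf i j  : star leaf o_{i,j}, adjacent to p_i
data CPSVertex (n m : ℕ) : Set where
  cyc  : Fin n → CPSVertex n m
  pend : Fin n → CPSVertex n m
  leaf : Fin n → Fin m → CPSVertex n m

-- Edge relation (one direction of each undirected edge; the labeling
-- condition is symmetric since Coprime is symmetric).
data CPSEdge (n m : ℕ) : CPSVertex n m → CPSVertex n m → Set where
  cycle-edge : (i j : Fin n) → toℕ j ≡ suc (toℕ i) →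
               CPSEdge n m (cyc i) (cyc j)
  cycle-close : (i j : Fin n) → suc (toℕ i) ≡ n → toℕ j ≡ 0 →
                CPSEdge n m (cyc i) (cyc j)
  pendant-edge : (i : Fin n) → CPSEdge n m (cyc i) (pend i)
  star-edge : (i : Fin n) (j : Fin m) → CPSEdge n m (pend i) (leaf i j)

cpsSize : ℕ → ℕ → ℕ
cpsSize n m = (m + 2) * n

-- A prime vertex labeling: a bijection from the vertices to Fin N, where
-- vertex v gets label  toℕ (f v) + 1  ∈ {1,…,N}, such that adjacent vertices
-- receive coprime labels.
record PrimeLabeling (n m : ℕ) : Set where
  field
    label      : CPSVertex n m ⤖ Fin (cpsSize n m)
    coprimeAdj : ∀ {u v} → CPSEdge n m u v →
                 Coprime (suc (toℕ (Bijection.to label u)))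
                         (suc (toℕ (Bijection.to label v)))

IsPrime : ℕ → ℕ → Set
IsPrime n m = PrimeLabeling n m

module Submission where

-- Let K = m + 2 ≤ 10 and cut {1, …, (m+2)n} into n consecutive
-- blocks of K labels, block i (0-based) being  b_i, b_i + 1, …, b_i + K - 1
-- with  b_i = 1 + K·i.  The i-th "spoke" c_i, p_i, o_{i,1..m} receives the
-- labels of block i:
--   * c_i gets b_i.  Consecutive b_i, b_{i+1} are coprime (any common divisor
--     divides K, hence 1 + K·i - K·i = 1), and the closing edge touches b_0 = 1.
--   * p_i gets b_i + s_i, where the offset s_i ≠ 0 is chosen so that b_i + s_i
--     is coprime to every other label of the block; the leaves take the rest.
-- Such an "isolated" offset exists in every window of at most 10 consecutive
-- integers (with the first position excluded).  Two labels of a window differ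
-- by 1 … 9, so they are coprime unless a prime q ∈ {2,3,5,7} divides both; this
-- condition only depends on b mod 210 = 2·3·5·7, so finitely many windows are
-- checked by a decision procedure.
-- The construction works for every n.

open import Defs
open import Data.Nat using (ℕ; suc; _+_; _*_; _∸_; _%_; _≤_; _<_; z≤n; s≤s; NonZero; >-nonZero)
open import Data.Nat.Properties using (+-assoc; +-comm; *-comm; *-suc; *-zeroʳ; +-identityʳ; ≤-trans; ≤-pred; <⇒≤; m∸n≤m; m<n⇒0<n∸m; m+[n∸m]≡n; <-cmp)
open import Data.Nat.Divisibility using (_∣_; _∣?_; divides; ∣-refl; ∣-trans; ∣⇒≤; 0∣⇒≡0; ∣1⇒≡1; ∣m+n∣m⇒∣n; ∣m⇒∣m*n; ∣n⇒∣m*n)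
open import Data.Nat.DivMod using (_/_; m≡m%n+[m/n]*n; m%n<n)
open import Data.Nat.Coprimality using (Coprime; 1-coprimeTo) renaming (sym to coprime-sym)
open import Data.Fin using (Fin; toℕ; fromℕ<; cast; combine; _≟_) renaming (zero to 0F; suc to sucF)
open import Data.Fin.Properties using (any?; all?; toℕ<n; toℕ-injective; toℕ-fromℕ<; toℕ-cast; toℕ-combine; *↔×)
open import Data.Fin.Permutation using (cast-id)
import Data.Fin.Permutation.Components as PC
open import Data.List using (List; _∷_; [])
open import Data.List.Relation.Unary.All using (All; _∷_; [])
import Data.List.Relation.Unary.All as All
open import Data.List.Relation.Unary.All.Properties using (All¬⇒¬Any)
open import Data.List.Relation.Unary.Any using (Any; here; there)
import Data.List.Relation.Unary.Any as Any
open import Data.Product using (_×_; _,_; proj₁; proj₂; ∃; swap)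
open import Data.Empty using (⊥-elim)
open import Relation.Nullary using (¬_; Dec; ¬?)
open import Relation.Nullary.Decidable using (_×-dec_; _→-dec_; from-yes; dec-true; dec-false)
open import Relation.Binary using (tri<; tri≈; tri>)
open import Relation.Binary.PropositionalEquality
open import Function using (_∘′_)
open import Function.Bundles using (Inverse; _↔_; mk↔ₛ′)
open import Function.Properties.Inverse using (↔-trans; ↔-sym; ↔⇒⤖)

smallPrimes : List ℕ
smallPrimes = 2 ∷ 3 ∷ 5 ∷ 7 ∷ []

NoCommonSmallPrime : ℕ → ℕ → Set
NoCommonSmallPrime x y = All (λ q → ¬ (q ∣ x × q ∣ y)) smallPrimes

noCommonSmallPrime? : ∀ x y → Dec (NoCommonSmallPrime x y)
noCommonSmallPrime? x y = All.all? (λ q → ¬? ((q ∣? x) ×-dec (q ∣? y))) smallPrimes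

noCommonSmallPrime-sym : ∀ {x y} → NoCommonSmallPrime x y → NoCommonSmallPrime y x
noCommonSmallPrime-sym = All.map (λ ¬both → ¬both ∘′ swap)

smallPrimeFactor : ∀ e → 2 ≤ e → e ≤ 9 → Any (_∣ e) smallPrimes
smallPrimeFactor 0 () _
smallPrimeFactor 1 (s≤s ()) _
smallPrimeFactor 2 _ _ = here ∣-refl
smallPrimeFactor 3 _ _ = there (here ∣-refl)
smallPrimeFactor 4 _ _ = here (divides 2 refl)
smallPrimeFactor 5 _ _ = there (there (here ∣-refl))
smallPrimeFactor 6 _ _ = here (divides 3 refl)
smallPrimeFactor 7 _ _ = there (there (there (here ∣-refl)))
smallPrimeFactor 8 _ _ = here (divides 4 refl)
smallPrimeFactor 9 _ _ = there (here (divides 3 refl))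
smallPrimeFactor (suc (suc (suc (suc (suc (suc (suc (suc (suc (suc _)))))))))) _
  (s≤s (s≤s (s≤s (s≤s (s≤s (s≤s (s≤s (s≤s (s≤s ())))))))))

-- x and x + d (1 ≤ d ≤ 9) are coprime unless a prime q ≤ 7 divides both:
-- a common divisor e divides d, so e ≤ 9, and if e ≥ 2 one of its prime
-- factors q ≤ 7 would be a common small prime factor.
coprime-nearby : ∀ x d → 1 ≤ d → d ≤ 9 → NoCommonSmallPrime x (x + d) → Coprime x (x + d)
coprime-nearby x d 1≤d d≤9 noCommon {0} (0∣x , 0∣x+d)
  with () ← subst (1 ≤_) (0∣⇒≡0 (∣m+n∣m⇒∣n 0∣x+d 0∣x)) 1≤d
coprime-nearby x d 1≤d d≤9 noCommon {1} _ = refl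
coprime-nearby x d 1≤d d≤9 noCommon {e@(suc (suc _))} (e∣x , e∣x+d) =
  ⊥-elim (All¬⇒¬Any noCommon (Any.map divBoth q∣e))
  where
  instance _ : NonZero d
  _ = >-nonZero 1≤d
  q∣e : Any (_∣ e) smallPrimes
  q∣e = smallPrimeFactor e (s≤s (s≤s z≤n)) (≤-trans (∣⇒≤ (∣m+n∣m⇒∣n e∣x+d e∣x)) d≤9)
  divBoth : ∀ {q} → q ∣ e → q ∣ x × q ∣ x + d
  divBoth q∣e = ∣-trans q∣e e∣x , ∣-trans q∣e e∣x+d

-- Positions u < v ≤ 9 of the window starting at b lie at distance v ∸ u ∈ [1, 9].
coprime-below : ∀ b u v → u < v → v ≤ 9 →
                NoCommonSmallPrime (b + u) (b + v) → Coprime (b + u) (b + v)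
coprime-below b u v u<v v≤9 noCommon =
  subst (Coprime (b + u)) (sym shift)
    (coprime-nearby (b + u) (v ∸ u) (m<n⇒0<n∸m u<v) (≤-trans (m∸n≤m v u) v≤9)
      (subst (NoCommonSmallPrime (b + u)) shift noCommon))
  where
  shift : b + v ≡ b + u + (v ∸ u)
  shift = begin
    b + v             ≡⟨ cong (b +_) (sym (m+[n∸m]≡n (<⇒≤ u<v))) ⟩
    b + (u + (v ∸ u)) ≡⟨ sym (+-assoc b u (v ∸ u)) ⟩
    b + u + (v ∸ u)   ∎
    where open ≡-Reasoning

coprime-in-window : ∀ b u v → u ≢ v → u ≤ 9 → v ≤ 9 →
                    NoCommonSmallPrime (b + u) (b + v) → Coprime (b + u) (b + v)
coprime-in-window b u v u≢v u≤9 v≤9 noCommon with <-cmp u v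
... | tri< u<v _ _ = coprime-below b u v u<v v≤9 noCommon
... | tri≈ _ u≡v _ = ⊥-elim (u≢v u≡v)
... | tri> _ _ v<u =
  coprime-sym (coprime-below b v u v<u u≤9 (noCommonSmallPrime-sym noCommon))

Isolated : (K b : ℕ) → Fin K → Set
Isolated K b s = ∀ o → o ≢ s → Coprime (b + toℕ s) (b + toℕ o)

HasSmallPrimeIsolated : (m b : ℕ) → Set
HasSmallPrimeIsolated m b =
  ∃ λ (s : Fin (2 + m)) → s ≢ 0F × (∀ o → o ≢ s → NoCommonSmallPrime (b + toℕ s) (b + toℕ o))

hasSmallPrimeIsolated? : ∀ m b → Dec (HasSmallPrimeIsolated m b)
hasSmallPrimeIsolated? m b = any? λ s →
  ¬? (s ≟ 0F) ×-dec all? λ o → ¬? (o ≟ s) →-dec noCommonSmallPrime? (b + toℕ s) (b + toℕ o)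

∣-mod : ∀ {q} b u p .{{_ : NonZero p}} → q ∣ p → q ∣ b + u → q ∣ b % p + u
∣-mod {q} b u p q∣p q∣b+u = ∣m+n∣m⇒∣n (subst (q ∣_) split q∣b+u) (∣n⇒∣m*n (b / p) q∣p)
  where
  split : b + u ≡ b / p * p + (b % p + u)
  split = begin
    b + u                   ≡⟨ cong (_+ u) (m≡m%n+[m/n]*n b p) ⟩
    b % p + b / p * p + u   ≡⟨ cong (_+ u) (+-comm (b % p) (b / p * p)) ⟩
    b / p * p + b % p + u   ≡⟨ +-assoc (b / p * p) (b % p) u ⟩
    b / p * p + (b % p + u) ∎
    where open ≡-Reasoning

-- Hence the small-prime condition is periodic in b with period 210 = 2·3·5·7.
noCommonSmallPrime-mod : ∀ b u v →
  NoCommonSmallPrime (b % 210 + u) (b % 210 + v) → NoCommonSmallPrime (b + u) (b + v)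
noCommonSmallPrime-mod b u v (¬2 ∷ ¬3 ∷ ¬5 ∷ ¬7 ∷ []) =
  reduce (divides 105 refl) ¬2 ∷ reduce (divides 70 refl) ¬3 ∷
  reduce (divides 42 refl) ¬5 ∷ reduce (divides 30 refl) ¬7 ∷ []
  where
  reduce : ∀ {q} → q ∣ 210 → ¬ (q ∣ b % 210 + u × q ∣ b % 210 + v) → ¬ (q ∣ b + u × q ∣ b + v)
  reduce q∣210 ¬both (q∣b+u , q∣b+v) = ¬both (∣-mod b u 210 q∣210 q∣b+u , ∣-mod b v 210 q∣210 q∣b+v)

residueTable? : ∀ m → Dec ((r : Fin 210) → HasSmallPrimeIsolated m (toℕ r))
residueTable? m = all? λ r → hasSmallPrimeIsolated? m (toℕ r)

residueTable : ∀ m → m ≤ 8 → (r : Fin 210) → HasSmallPrimeIsolated m (toℕ r)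
residueTable 0 _ = from-yes (residueTable? 0)
residueTable 1 _ = from-yes (residueTable? 1)
residueTable 2 _ = from-yes (residueTable? 2)
residueTable 3 _ = from-yes (residueTable? 3)
residueTable 4 _ = from-yes (residueTable? 4)
residueTable 5 _ = from-yes (residueTable? 5)
residueTable 6 _ = from-yes (residueTable? 6)
residueTable 7 _ = from-yes (residueTable? 7)
residueTable 8 _ = from-yes (residueTable? 8)
residueTable (suc (suc (suc (suc (suc (suc (suc (suc (suc _)))))))))
  (s≤s (s≤s (s≤s (s≤s (s≤s (s≤s (s≤s (s≤s ()))))))))

-- Every window of m + 2 ≤ 10 consecutive integers has an isolated entry
-- other than its first one: take the position found for b mod 210.
isolated-exists : ∀ m → m ≤ 8 → ∀ b → ∃ λ (s : Fin (2 + m)) → s ≢ 0F × Isolated (2 + m) b s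
isolated-exists m m≤8 b with residueTable m m≤8 (fromℕ< (m%n<n b 210))
... | s , s≢0 , noCommon = s , s≢0 , λ o o≢s →
  coprime-in-window b (toℕ s) (toℕ o) (λ eq → o≢s (sym (toℕ-injective eq)))
    (position≤9 s) (position≤9 o)
    (noCommonSmallPrime-mod b (toℕ s) (toℕ o)
      (subst (λ r → NoCommonSmallPrime (r + toℕ s) (r + toℕ o))
        (toℕ-fromℕ< (m%n<n b 210)) (noCommon o o≢s)))
  where
  position≤9 : (p : Fin (2 + m)) → toℕ p ≤ 9
  position≤9 p = ≤-pred (≤-trans (toℕ<n p) (s≤s (s≤s m≤8)))

transpose-matchˡ : ∀ {k} (i j : Fin k) → PC.transpose i j i ≡ j
transpose-matchˡ i j rewrite dec-true (i ≟ i) refl = refl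

transpose-other : ∀ {k} (i j l : Fin k) → l ≢ i → l ≢ j → PC.transpose i j l ≡ l
transpose-other i j l l≢i l≢j rewrite dec-false (l ≟ i) l≢i | dec-false (l ≟ j) l≢j = refl

-- 1 + K·a and 1 + K·(a + 1) are coprime: a common divisor divides their
-- difference K, hence K·a, hence 1.
consecutive-blocks-coprime : ∀ K a → Coprime (suc (K * a)) (suc (K * suc a))
consecutive-blocks-coprime K a {e} (e∣x , e∣y) = ∣1⇒≡1 (∣m+n∣m⇒∣n e∣Ka+1 (∣m⇒∣m*n a e∣K))
  where
  e∣K : e ∣ K
  e∣K = ∣m+n∣m⇒∣n (subst (e ∣_) (cong suc (trans (*-suc K a) (+-comm K (K * a)))) e∣y) e∣x
  e∣Ka+1 : e ∣ K * a + 1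
  e∣Ka+1 = subst (e ∣_) (+-comm 1 (K * a)) e∣x

module BlockLabelling (n m : ℕ) (m≤8 : m ≤ 8) where

  K : ℕ
  K = 2 + m

  blockStart : Fin n → ℕ
  blockStart i = suc (K * toℕ i)

  pendantPos : Fin n → Fin K
  pendantPos i = proj₁ (isolated-exists m m≤8 (blockStart i))

  pendantPos≢0 : ∀ i → pendantPos i ≢ 0F
  pendantPos≢0 i = proj₁ (proj₂ (isolated-exists m m≤8 (blockStart i)))

  pendantPos-isolated : ∀ i → Isolated K (blockStart i) (pendantPos i)
  pendantPos-isolated i = proj₂ (proj₂ (isolated-exists m m≤8 (blockStart i)))

  coordinates : CPSVertex n m ↔ (Fin n × Fin K)
  coordinates = mk↔ₛ′ to from
    (λ { (i , 0F) → refl ; (i , sucF 0F) → refl ; (i , sucF (sucF j)) → refl })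
    (λ { (cyc i) → refl ; (pend i) → refl ; (leaf i j) → refl })
    where
    to : CPSVertex n m → Fin n × Fin K
    to (cyc i) = i , 0F
    to (pend i) = i , sucF 0F
    to (leaf i j) = i , sucF (sucF j)
    from : Fin n × Fin K → CPSVertex n m
    from (i , 0F) = cyc i
    from (i , sucF 0F) = pend i
    from (i , sucF (sucF j)) = leaf i j

  reorder : (Fin n × Fin K) ↔ (Fin n × Fin K)
  reorder = mk↔ₛ′
    (λ (i , p) → i , PC.transpose (sucF 0F) (pendantPos i) p)
    (λ (i , p) → i , PC.transpose (pendantPos i) (sucF 0F) p)
    (λ (i , p) → cong (i ,_) (PC.transpose-inverse (sucF 0F) (pendantPos i)))
    (λ (i , p) → cong (i ,_) (PC.transpose-inverse (pendantPos i) (sucF 0F)))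

  size : n * K ≡ cpsSize n m
  size = trans (*-comm n K) (cong (_* n) (+-comm 2 m))

  labelling : CPSVertex n m ↔ Fin (cpsSize n m)
  labelling = ↔-trans (↔-trans coordinates reorder) (↔-trans (↔-sym *↔×) (cast-id size))

  labelOf : CPSVertex n m → ℕ
  labelOf v = suc (toℕ (Inverse.to labelling v))

  label-in-block : ∀ i p → suc (toℕ (cast size (combine i p))) ≡ blockStart i + toℕ p
  label-in-block i p = cong suc (trans (toℕ-cast size (combine i p)) (toℕ-combine i p))

  -- c_i keeps position 0, since pendantPos i ≠ 0.
  label-cyc : ∀ i → labelOf (cyc i) ≡ blockStart i
  label-cyc i = begin
    labelOf (cyc i)         ≡⟨ label-in-block i cycPos ⟩
    blockStart i + toℕ cycPos ≡⟨ cong (λ p → blockStart i + toℕ p) fixed ⟩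
    blockStart i + 0        ≡⟨ +-identityʳ (blockStart i) ⟩
    blockStart i            ∎
    where
    open ≡-Reasoning
    cycPos : Fin K
    cycPos = PC.transpose (sucF 0F) (pendantPos i) 0F
    fixed : cycPos ≡ 0F
    fixed = transpose-other (sucF 0F) (pendantPos i) 0F (λ ()) (λ eq → pendantPos≢0 i (sym eq))

  label-pend : ∀ i → labelOf (pend i) ≡ blockStart i + toℕ (pendantPos i)
  label-pend i = trans (label-in-block i (PC.transpose (sucF 0F) (pendantPos i) (sucF 0F)))
    (cong (λ p → blockStart i + toℕ p) (transpose-matchˡ (sucF 0F) (pendantPos i)))

  leafPos : Fin n → Fin m → Fin K
  leafPos i j = PC.transpose (sucF 0F) (pendantPos i) (sucF (sucF j))

  label-leaf : ∀ i j → labelOf (leaf i j) ≡ blockStart i + toℕ (leafPos i j)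
  label-leaf i j = label-in-block i (leafPos i j)

  -- Leaves never occupy the pendant position, the transposition being injective.
  leafPos≢pendantPos : ∀ i j → leafPos i j ≢ pendantPos i
  leafPos≢pendantPos i j eq = position2+≢1 (begin
    sucF (sucF j)                                        ≡⟨ sym (PC.transpose-inverse (pendantPos i) (sucF 0F)) ⟩
    PC.transpose (pendantPos i) (sucF 0F) (leafPos i j)   ≡⟨ cong (PC.transpose (pendantPos i) (sucF 0F)) eq ⟩
    PC.transpose (pendantPos i) (sucF 0F) (pendantPos i) ≡⟨ transpose-matchˡ (pendantPos i) (sucF 0F) ⟩
    sucF 0F                                              ∎)
    where
    open ≡-Reasoning
    position2+≢1 : sucF (sucF j) ≢ sucF 0F
    position2+≢1 ()

  coprime-edge : ∀ {u v} → CPSEdge n m u v → Coprime (labelOf u) (labelOf v)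
  coprime-edge (cycle-edge i j j≡i+1) rewrite label-cyc i | label-cyc j | j≡i+1 =
    consecutive-blocks-coprime K (toℕ i)
  coprime-edge (cycle-close i j _ j≡0) rewrite label-cyc i | label-cyc j | j≡0 | *-zeroʳ K =
    coprime-sym (1-coprimeTo (blockStart i))
  coprime-edge (pendant-edge i) rewrite label-cyc i | label-pend i =
    subst (λ x → Coprime x (blockStart i + toℕ (pendantPos i))) (+-identityʳ (blockStart i))
      (coprime-sym (pendantPos-isolated i 0F (λ eq → pendantPos≢0 i (sym eq))))
  coprime-edge (star-edge i j) rewrite label-pend i | label-leaf i j =
    pendantPos-isolated i (leafPos i j) (leafPos≢pendantPos i j)

theorem1 : (n m : ℕ) → 3 ≤ n → m ≤ 8 → IsPrime n m
theorem1 n m _ m≤8 = record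
  { label      = ↔⇒⤖ labelling
  ; coprimeAdj = coprime-edge
  }
  where open BlockLabelling n m m≤8
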